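{- Let $\mathcal{H}$ be a $3$-partite $3$-graph with vertex classes $V_1,V_2,V_3$ such that each link $\mathrm{lk}_{\mathcal{H}}(V_i)$ has a perfect matching. Suppose $X\subseteq V_j$ is a minimal equineighbored set of $\mathrm{lk}_{\mathcal{H}}(V_i)$ with $|X|=2$, and suppose no two disjoint edges of $\mathcal{H}$ both meet $X$. Then the edges of $\mathcal{H}$ incident to $X$ form a truncated multi-Fano plane.
   Context: A $3$-partite $3$-graph has vertex classes $V_1,V_2,V_3$ and a multiset of edges, each containing exactly one vertex per class. For $S\subseteq V_i$, $\{i,j,k\}=\{1,2,3\}$, the link graph $\mathrm{lk}_{\mathcal{H}}(S)$ is the bipartite multigraph with classes $V_j,V_k$ and edge multiset $\{e\setminus V_i: e\in E(\mathcal{H}), e\cap V_i\subseteq S\}$. In a bipartite graph, a nonempty subset $X$ of a vertex class is equineighbored if $|N(X)|=|X|$; it is minimal if no proper subset is equineighbored. The truncated Fano plane is the $3$-graph on $\{a,b,c,x,y,z\}$ with edges $abc,ayz,xbz,xyc$; a truncated multi-Fano plane is obtained from it by adding edges parallel to existing edges. -}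

module Defs where

open import Data.Nat using (ℕ)
open import Data.Bool using (Bool; true; false; if_then_else_)
open import Data.Fin using (Fin; zero; suc)
open import Data.Fin.Subset using (Subset; ⊥; ⊤; ⁅_⁆; _∪_; ∣_∣; Nonempty; _⊂_; _∈_)
open import Data.List using (List; []; _∷_; map; filterᵇ; length; lookup)
open import Data.List.Relation.Unary.All using (All)
open import Data.List.Relation.Unary.Any using (Any)
open import Data.List.Relation.Unary.Unique.Propositional using (Unique)
open import Data.Product using (Σ; Σ-syntax; ∃; ∃-syntax; _×_; _,_; proj₁; proj₂)
open import Data.Sum using (_⊎_)
open import Data.Vec using () renaming (lookup to vlookup)
open import Relation.Binary.PropositionalEquality using (_≡_; _≢_)
open import Relation.Nullary using (¬_)
open import Function.Bundles using (_⇔_)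

-- 3-partite 3-graphs
-- Vertex class V_l is Fin (n l), for l : Fin 3.
-- An edge picks exactly one vertex from every class.
-- The edge multiset is a list (multiplicities = repetitions).

Edge : (Fin 3 → ℕ) → Set
Edge n = (l : Fin 3) → Fin (n l)

record TriGraph : Set where
  field
    n     : Fin 3 → ℕ
    edges : List (Edge n)
open TriGraph public

Vertex : (Fin 3 → ℕ) → Set
Vertex n = Σ (Fin 3) (λ l → Fin (n l))

_∈ₑ_ : {n : Fin 3 → ℕ} → Vertex n → Edge n → Set
(l , v) ∈ₑ e = e l ≡ v

EdgeIs : {n : Fin 3 → ℕ} → Edge n → Vertex n → Vertex n → Vertex n → Set
EdgeIs {n} e p q r = (v : Vertex n) → (v ∈ₑ e) ⇔ (v ≡ p ⊎ v ≡ q ⊎ v ≡ r)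

-- the third index in {0,1,2} different from i and j (only used for i ≢ j)
third : Fin 3 → Fin 3 → Fin 3
third zero (suc zero) = suc (suc zero)
third zero (suc (suc zero)) = suc zero
third (suc zero) zero = suc (suc zero)
third (suc zero) (suc (suc zero)) = zero
third (suc (suc zero)) zero = suc zero
third (suc (suc zero)) (suc zero) = zero
third _ _ = zero

BipMulti : ℕ → ℕ → Set
BipMulti a b = List (Fin a × Fin b)

-- link graph lk_H(S), S ⊆ V_i, with classes V_j and V_k:
-- edge multiset { e \ V_i : e ∈ E(H), e ∩ V_i ⊆ S }
link : (H : TriGraph) (i : Fin 3) → Subset (n H i) → (j k : Fin 3)
     → BipMulti (n H j) (n H k)
link H i S j k = map (λ e → (e j , e k)) (filterᵇ (λ e → vlookup S (e i)) (edges H))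

-- perfect matching: a sub-multiset M of the edges (given by positions)
-- such that every vertex on either side lies in exactly one edge of M
PerfectMatching : {a b : ℕ} → BipMulti a b → Set
PerfectMatching {a} {b} G =
  Σ[ M ∈ Subset (length G) ]
    (((v : Fin a) → ∃[ t ] (t ∈ M × proj₁ (lookup G t) ≡ v
        × ((t' : Fin (length G)) → t' ∈ M → proj₁ (lookup G t') ≡ v → t' ≡ t)))
    × ((w : Fin b) → ∃[ t ] (t ∈ M × proj₂ (lookup G t) ≡ w
        × ((t' : Fin (length G)) → t' ∈ M → proj₂ (lookup G t') ≡ w → t' ≡ t))))

N : {a b : ℕ} → BipMulti a b → Subset a → Subset b
N [] X = ⊥
N ((v , w) ∷ G) X = if vlookup X v then ⁅ w ⁆ ∪ N G X else N G X

Equineighbored : {a b : ℕ} → BipMulti a b → Subset a → Set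
Equineighbored G X = Nonempty X × ∣ N G X ∣ ≡ ∣ X ∣

MinimalEquineighbored : {a b : ℕ} → BipMulti a b → Subset a → Set
MinimalEquineighbored {a} G X =
  Equineighbored G X × ((Y : Subset a) → Y ⊂ X → ¬ Equineighbored G Y)

incident : (H : TriGraph) (j : Fin 3) → Subset (n H j) → List (Edge (n H))
incident H j X = filterᵇ (λ e → vlookup X (e j)) (edges H)

TruncatedMultiFano : {n : Fin 3 → ℕ} → List (Edge n) → Set
TruncatedMultiFano {n} L =
  Σ[ a ∈ Vertex n ] Σ[ b ∈ Vertex n ] Σ[ c ∈ Vertex n ]
  Σ[ x ∈ Vertex n ] Σ[ y ∈ Vertex n ] Σ[ z ∈ Vertex n ]
    ( Unique (a ∷ b ∷ c ∷ x ∷ y ∷ z ∷ [])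
    × All (λ e → EdgeIs e a b c ⊎ EdgeIs e a y z ⊎ EdgeIs e x b z ⊎ EdgeIs e x y c) L
    × Any (λ e → EdgeIs e a b c) L
    × Any (λ e → EdgeIs e a y z) L
    × Any (λ e → EdgeIs e x b z) L
    × Any (λ e → EdgeIs e x y c) L )

-- Write X = {x₁, x₂} and N(X) = {y₁, y₂} in the link of V_i. A singleton {x} ⊂ X has a
-- neighbour (the link has a perfect matching) but is not equineighbored (minimality), so
-- N({x}) = N(X): every pair x_a y_b lies in an edge of H. Edges at opposite pairs
-- (x₁y₁ and x₂y₂, or x₁y₂ and x₂y₁) must meet, and can only do so in V_i; hence the edges
-- at x₁y₁ and x₂y₂ share a vertex c₁, those at x₁y₂ and x₂y₁ a vertex c₂, which gives a
-- truncated multi-Fano plane once c₁ ≠ c₂. If c₁ = c₂, then in the link of V_k both x₁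
-- and x₂ have c₁ as their only neighbour, which a perfect matching forbids.
module Submission where

open import Defs
open import Data.Fin using (Fin)
open import Data.Fin.Subset using (Subset; ⊤; ∣_∣; _∈_)
open import Data.List.Membership.Propositional using () renaming (_∈_ to _∈ₗ_)
open import Data.List.Membership.Propositional using (lose)
open import Data.List.Relation.Unary.Unique.Propositional using (Unique)
open import Data.Product using (∃-syntax)
open import Relation.Binary.PropositionalEquality using (_≡_; _≢_)

open import Data.Bool using (T; true; false)
open import Data.Bool.Properties using (T-≡)
open import Data.Fin using (zero; suc)
import Data.Fin.Properties as Finₚ
open import Data.Fin.Subset
  using (inside; outside; Nonempty; _⊆_; _⊂_; ⁅_⁆)
open import Data.Fin.Subset.Properties
  using (x∈⁅x⁆; x∈⁅y⁆⇒x≡y; ∣⁅x⁆∣≡1; ∣⊥∣≡0; ∉⊥; ∈⊤; x∈p∪q⁻; p⊆p∪q; q⊆p∪q;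
         p⊆q⇒∣p∣≤∣q∣; p⊂q⇒∣p∣<∣q∣; Empty-unique; nonempty?; _∈?_)
open import Data.List using ([]; _∷_; lookup)
open import Data.List.Membership.Propositional.Properties
  using (∈-map⁺; ∈-map⁻; ∈-filter⁺; ∈-filter⁻; ∈-lookup)
open import Data.List.Relation.Unary.All using ([]; _∷_; tabulate)
open import Data.List.Relation.Unary.AllPairs using ([]; _∷_)
open import Data.List.Relation.Unary.Any using (Any; here; there)
open import Data.Nat using (ℕ; _≤_; _<_)
open import Data.Nat.Properties using (≤-antisym; ≤-pred; suc-injective; <-irrefl)
open import Data.Product using (_×_; _,_; proj₁; proj₂; uncurry′)
open import Data.Product.Properties using (,-injectiveˡ; ,-injectiveʳ-UIP)
open import Data.Sum using (_⊎_; inj₁; inj₂; [_,_]′) renaming (map to ⊎-map)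
open import Data.Vec using ([]; _∷_; here; there) renaming (lookup to vlookup)
open import Data.Vec.Properties using ([]=⇒lookup; lookup⇒[]=)
open import Function using (_∘_; _∋_; id)
open import Function.Bundles using (mk⇔; Equivalence)
open import Relation.Nullary using (yes; no; contradiction)
open import Relation.Nullary.Decidable using (T?)
open import Relation.Binary.PropositionalEquality
  using (refl; sym; trans; cong; subst; subst₂; ≢-sym)
open import Axiom.UniquenessOfIdentityProofs using (module Decidable⇒UIP)

module _ {m : ℕ} {p : Subset m} where

  ∈⇒T : ∀ {x} → x ∈ p → T (vlookup p x)
  ∈⇒T x∈p = Equivalence.from T-≡ ([]=⇒lookup x∈p)

  T⇒∈ : ∀ {x} → T (vlookup p x) → x ∈ p
  T⇒∈ t = lookup⇒[]= _ p (Equivalence.to T-≡ t)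

  x∈p⇒⁅x⁆⊆p : ∀ {x} → x ∈ p → ⁅ x ⁆ ⊆ p
  x∈p⇒⁅x⁆⊆p {x} x∈p y∈⁅x⁆ = subst (_∈ p) (sym (x∈⁅y⁆⇒x≡y x y∈⁅x⁆)) x∈p

  x∈p⇒0<∣p∣ : ∀ {x} → x ∈ p → 0 < ∣ p ∣
  x∈p⇒0<∣p∣ {x} x∈p = subst (_≤ ∣ p ∣) (∣⁅x⁆∣≡1 x) (p⊆q⇒∣p∣≤∣q∣ (x∈p⇒⁅x⁆⊆p x∈p))

  ⁅x⁆⊂p : ∀ {x y} → x ∈ p → y ∈ p → x ≢ y → ⁅ x ⁆ ⊂ p
  ⁅x⁆⊂p {x} x∈p y∈p x≢y = x∈p⇒⁅x⁆⊆p x∈p , _ , y∈p , x≢y ∘ sym ∘ x∈⁅y⁆⇒x≡y x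

  ∣p∣≡1⇒singleton : ∣ p ∣ ≡ 1 → ∃[ x ] (x ∈ p × ∀ {y} → y ∈ p → y ≡ x)
  ∣p∣≡1⇒singleton ∣p∣≡1 with nonempty? p
  ... | no empty = contradiction (trans (sym ∣p∣≡1) (trans (cong ∣_∣ (Empty-unique empty)) (∣⊥∣≡0 m))) λ ()
  ... | yes (x , x∈p) = x , x∈p , unique
    where
    unique : ∀ {y} → y ∈ p → y ≡ x
    unique {y} y∈p with y Finₚ.≟ x
    ... | yes y≡x = y≡x
    ... | no y≢x = contradiction (subst₂ _<_ (∣⁅x⁆∣≡1 y) ∣p∣≡1 (p⊂q⇒∣p∣<∣q∣ (⁅x⁆⊂p y∈p x∈p y≢x))) (<-irrefl refl)

record Pair {m : ℕ} (p : Subset m) : Set where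
  field
    fst snd : Fin m
    fst≢snd : fst ≢ snd
    fst∈    : fst ∈ p
    snd∈    : snd ∈ p
    ∈-pair  : ∀ {x} → x ∈ p → x ≡ fst ⊎ x ≡ snd

∣p∣≡2⇒Pair : ∀ {m} {p : Subset m} → ∣ p ∣ ≡ 2 → Pair p
∣p∣≡2⇒Pair {p = outside ∷ p} ∣p∣≡2 = record
  { fst = suc fst ; snd = suc snd ; fst≢snd = fst≢snd ∘ Finₚ.suc-injective
  ; fst∈ = there fst∈ ; snd∈ = there snd∈
  ; ∈-pair = λ { (there x∈p) → ⊎-map (cong suc) (cong suc) (∈-pair x∈p) } }
  where open Pair (∣p∣≡2⇒Pair {p = p} ∣p∣≡2)
∣p∣≡2⇒Pair {p = inside ∷ p} ∣p∣≡2 with ∣p∣≡1⇒singleton (suc-injective ∣p∣≡2)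
... | x , x∈p , unique = record
  { fst = zero ; snd = suc x ; fst≢snd = λ () ; fst∈ = here ; snd∈ = there x∈p
  ; ∈-pair = λ { here → inj₁ refl ; (there y∈p) → inj₂ (cong suc (unique y∈p)) } }

module _ {a b : ℕ} where

  ∈-N⁺ : ∀ (G : BipMulti a b) {Y v w} → (v , w) ∈ₗ G → v ∈ Y → w ∈ N G Y
  ∈-N⁺ ((v , w) ∷ G) {Y} (here refl) v∈Y with vlookup Y v in eq
  ... | true  = p⊆p∪q (N G Y) (x∈⁅x⁆ w)
  ... | false = contradiction (trans (sym ([]=⇒lookup v∈Y)) eq) λ ()
  ∈-N⁺ ((v' , _) ∷ G) {Y} (there vw∈G) v∈Y with vlookup Y v'
  ... | true  = q⊆p∪q _ (N G Y) (∈-N⁺ G vw∈G v∈Y)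
  ... | false = ∈-N⁺ G vw∈G v∈Y

  ∈-N⁻ : ∀ (G : BipMulti a b) {Y w} → w ∈ N G Y → ∃[ v ] ((v , w) ∈ₗ G × v ∈ Y)
  ∈-N⁻ [] w∈ = contradiction w∈ ∉⊥
  ∈-N⁻ ((v , w') ∷ G) {Y} w∈ with vlookup Y v in eq
  ∈-N⁻ ((v , w') ∷ G) {Y} w∈ | false with ∈-N⁻ G w∈
  ... | u , uw∈G , u∈Y = u , there uw∈G , u∈Y
  ∈-N⁻ ((v , w') ∷ G) {Y} w∈ | true with x∈p∪q⁻ ⁅ w' ⁆ (N G Y) w∈
  ... | inj₁ w∈⁅w'⁆ rewrite x∈⁅y⁆⇒x≡y w' w∈⁅w'⁆ = v , here refl , lookup⇒[]= v Y eq
  ... | inj₂ w∈N with ∈-N⁻ G w∈N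
  ...   | u , uw∈G , u∈Y = u , there uw∈G , u∈Y

  N-mono : ∀ (G : BipMulti a b) {Y Z} → Y ⊆ Z → N G Y ⊆ N G Z
  N-mono G Y⊆Z w∈ with ∈-N⁻ G w∈
  ... | v , vw∈G , v∈Y = ∈-N⁺ G vw∈G (Y⊆Z v∈Y)

  module _ {G : BipMulti a b} (pm : PerfectMatching G) where

    PerfectMatching⇒neighbour : ∀ v → ∃[ w ] ((v , w) ∈ₗ G)
    PerfectMatching⇒neighbour v with proj₁ (proj₂ pm) v
    ... | t , _ , refl , _ = proj₂ (lookup G t) , ∈-lookup t

    -- Matching partners of distinct right vertices are distinct.
    PerfectMatching⇒soleNeighbour-injective : ∀ {c w₁ w₂}
      → (∀ {v} → (v , w₁) ∈ₗ G → v ≡ c) → (∀ {v} → (v , w₂) ∈ₗ G → v ≡ c) → w₁ ≡ w₂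
    PerfectMatching⇒soleNeighbour-injective {c} {w₁} {w₂} only₁ only₂
      with proj₂ (proj₂ pm) w₁ | proj₂ (proj₂ pm) w₂ | proj₁ (proj₂ pm) c
    ... | t₁ , t₁∈M , refl , _ | t₂ , t₂∈M , refl , _ | _ , _ , _ , unique-at-c =
      cong (proj₂ ∘ lookup G) (trans (unique-at-c t₁ t₁∈M (only₁ (∈-lookup t₁)))
                                (sym (unique-at-c t₂ t₂∈M (only₂ (∈-lookup t₂)))))

  minimal⇒N⊆N⁅x⁆ : ∀ {G : BipMulti a b} {X x} → MinimalEquineighbored G X → ∣ X ∣ ≡ 2
    → ⁅ x ⁆ ⊂ X → Nonempty (N G ⁅ x ⁆) → N G X ⊆ N G ⁅ x ⁆
  minimal⇒N⊆N⁅x⁆ {G} {X} {x} ((_ , ∣NX∣≡∣X∣) , minimal) ∣X∣≡2 ⁅x⁆⊂X (_ , w∈N⁅x⁆) {z} z∈NX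
    with z ∈? N G ⁅ x ⁆
  ... | yes z∈N⁅x⁆ = z∈N⁅x⁆
  ... | no z∉N⁅x⁆ = contradiction ((x , x∈⁅x⁆ x) , trans ∣N⁅x⁆∣≡1 (sym (∣⁅x⁆∣≡1 x))) (minimal ⁅ x ⁆ ⁅x⁆⊂X)
    where
    ∣N⁅x⁆∣<2 : ∣ N G ⁅ x ⁆ ∣ < 2
    ∣N⁅x⁆∣<2 = subst (∣ N G ⁅ x ⁆ ∣ <_) (trans ∣NX∣≡∣X∣ ∣X∣≡2)
                 (p⊂q⇒∣p∣<∣q∣ (N-mono G (proj₁ ⁅x⁆⊂X) , z , z∈NX , z∉N⁅x⁆))
    ∣N⁅x⁆∣≡1 : ∣ N G ⁅ x ⁆ ∣ ≡ 1
    ∣N⁅x⁆∣≡1 = ≤-antisym (≤-pred ∣N⁅x⁆∣<2) (x∈p⇒0<∣p∣ w∈N⁅x⁆)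

record Distinct₃ (i j k : Fin 3) : Set where
  field
    i≢j   : i ≢ j
    i≢k   : i ≢ k
    j≢k   : j ≢ k
    cover : ∀ l → l ≡ i ⊎ l ≡ j ⊎ l ≡ k

third-distinct : ∀ {i j} → i ≢ j → Distinct₃ i j (third i j)
third-distinct {zero} {zero} i≢j = contradiction refl i≢j
third-distinct {zero} {suc zero} _ = record { i≢j = λ () ; i≢k = λ () ; j≢k = λ ()
  ; cover = λ { zero → inj₁ refl ; (suc zero) → inj₂ (inj₁ refl) ; (suc (suc zero)) → inj₂ (inj₂ refl) } }
third-distinct {zero} {suc (suc zero)} _ = record { i≢j = λ () ; i≢k = λ () ; j≢k = λ ()
  ; cover = λ { zero → inj₁ refl ; (suc zero) → inj₂ (inj₂ refl) ; (suc (suc zero)) → inj₂ (inj₁ refl) } }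
third-distinct {suc zero} {zero} _ = record { i≢j = λ () ; i≢k = λ () ; j≢k = λ ()
  ; cover = λ { zero → inj₂ (inj₁ refl) ; (suc zero) → inj₁ refl ; (suc (suc zero)) → inj₂ (inj₂ refl) } }
third-distinct {suc zero} {suc zero} i≢j = contradiction refl i≢j
third-distinct {suc zero} {suc (suc zero)} _ = record { i≢j = λ () ; i≢k = λ () ; j≢k = λ ()
  ; cover = λ { zero → inj₂ (inj₂ refl) ; (suc zero) → inj₁ refl ; (suc (suc zero)) → inj₂ (inj₁ refl) } }
third-distinct {suc (suc zero)} {zero} _ = record { i≢j = λ () ; i≢k = λ () ; j≢k = λ ()
  ; cover = λ { zero → inj₂ (inj₁ refl) ; (suc zero) → inj₂ (inj₂ refl) ; (suc (suc zero)) → inj₁ refl } }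
third-distinct {suc (suc zero)} {suc zero} _ = record { i≢j = λ () ; i≢k = λ () ; j≢k = λ ()
  ; cover = λ { zero → inj₂ (inj₂ refl) ; (suc zero) → inj₂ (inj₁ refl) ; (suc (suc zero)) → inj₁ refl } }
third-distinct {suc (suc zero)} {suc (suc zero)} i≢j = contradiction refl i≢j

third-third : ∀ {i j} → i ≢ j → third (third i j) i ≡ j
third-third {zero} {zero} i≢j = contradiction refl i≢j
third-third {zero} {suc zero} _ = refl
third-third {zero} {suc (suc zero)} _ = refl
third-third {suc zero} {zero} _ = refl
third-third {suc zero} {suc zero} i≢j = contradiction refl i≢j
third-third {suc zero} {suc (suc zero)} _ = refl
third-third {suc (suc zero)} {zero} _ = refl
third-third {suc (suc zero)} {suc zero} _ = refl
third-third {suc (suc zero)} {suc (suc zero)} i≢j = contradiction refl i≢j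

module _ {m : Fin 3 → ℕ} where

  vertex-≢ˡ : ∀ {l l'} {v : Fin (m l)} {w : Fin (m l')} → l ≢ l' → (Vertex m ∋ (l , v)) ≢ (l' , w)
  vertex-≢ˡ l≢l' = l≢l' ∘ ,-injectiveˡ

  vertex-≢ʳ : ∀ {l} {v w : Fin (m l)} → v ≢ w → (Vertex m ∋ (l , v)) ≢ (l , w)
  vertex-≢ʳ v≢w = v≢w ∘ ,-injectiveʳ-UIP (Decidable⇒UIP.≡-irrelevant Finₚ._≟_)

  edgeIs : ∀ {e : Edge m} {p q r u v w} → (∀ l → l ≡ p ⊎ l ≡ q ⊎ l ≡ r)
    → e p ≡ u → e q ≡ v → e r ≡ w → EdgeIs e (p , u) (q , v) (r , w)
  edgeIs {e} {p} {q} {r} {u} {v} {w} cover ep≡u eq≡v er≡w (l , t) = mk⇔ (to l t (cover l)) from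
    where
    to : ∀ l t → l ≡ p ⊎ l ≡ q ⊎ l ≡ r → e l ≡ t
       → (Vertex m ∋ (l , t)) ≡ (p , u) ⊎ (l , t) ≡ (q , v) ⊎ (l , t) ≡ (r , w)
    to l t (inj₁ refl)        refl = inj₁ (cong (p ,_) ep≡u)
    to l t (inj₂ (inj₁ refl)) refl = inj₂ (inj₁ (cong (q ,_) eq≡v))
    to l t (inj₂ (inj₂ refl)) refl = inj₂ (inj₂ (cong (r ,_) er≡w))
    from : (Vertex m ∋ (l , t)) ≡ (p , u) ⊎ (l , t) ≡ (q , v) ⊎ (l , t) ≡ (r , w) → e l ≡ t
    from (inj₁ refl)        = ep≡u
    from (inj₂ (inj₁ refl)) = eq≡v
    from (inj₂ (inj₂ refl)) = er≡w

module _ (H : TriGraph) (i : Fin 3) (S : Subset (n H i)) (j k : Fin 3) where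

  ∈-link⁺ : ∀ {e} → e ∈ₗ edges H → e i ∈ S → (e j , e k) ∈ₗ link H i S j k
  ∈-link⁺ e∈H ei∈S = ∈-map⁺ _ (∈-filter⁺ (T? ∘ λ e → vlookup S (e i)) e∈H (∈⇒T ei∈S))

  ∈-link⁻ : ∀ {p} → p ∈ₗ link H i S j k → ∃[ e ] (e ∈ₗ edges H × p ≡ (e j , e k))
  ∈-link⁻ p∈link with ∈-map⁻ _ p∈link
  ... | e , e∈filter , p≡ = e , proj₁ (∈-filter⁻ _ e∈filter) , p≡

module _ (H : TriGraph) (j : Fin 3) (X : Subset (n H j)) where

  ∈-incident⁺ : ∀ {e} → e ∈ₗ edges H → e j ∈ X → e ∈ₗ incident H j X
  ∈-incident⁺ e∈H ej∈X = ∈-filter⁺ (T? ∘ λ e → vlookup X (e j)) e∈H (∈⇒T ej∈X)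

  ∈-incident⁻ : ∀ {e} → e ∈ₗ incident H j X → e ∈ₗ edges H × e j ∈ X
  ∈-incident⁻ e∈inc with ∈-filter⁻ _ e∈inc
  ... | e∈H , t = e∈H , T⇒∈ t

module IncidentToPair (H : TriGraph) {i j k : Fin 3} (ijk : Distinct₃ i j k)
  (pm-i : PerfectMatching (link H i ⊤ j k)) (pm-k : PerfectMatching (link H k ⊤ i j))
  {X : Subset (n H j)} (minimal : MinimalEquineighbored (link H i ⊤ j k) X) (∣X∣≡2 : ∣ X ∣ ≡ 2)
  (intersecting : (e f : Edge (n H)) → e ∈ₗ edges H → f ∈ₗ edges H
                → e j ∈ X → f j ∈ X → ∃[ l ] e l ≡ f l)
  where

  open Distinct₃ ijk

  G : BipMulti (n H j) (n H k)
  G = link H i ⊤ j k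

  open Pair (∣p∣≡2⇒Pair {p = X} ∣X∣≡2)
    renaming (fst to x₁; snd to x₂; fst≢snd to x₁≢x₂; fst∈ to x₁∈X; snd∈ to x₂∈X; ∈-pair to ∈X)
  open Pair (∣p∣≡2⇒Pair {p = N G X} (trans (proj₂ (proj₁ minimal)) ∣X∣≡2))
    renaming (fst to y₁; snd to y₂; fst≢snd to y₁≢y₂; fst∈ to y₁∈NX; snd∈ to y₂∈NX; ∈-pair to ∈NX)

  record EdgeAt (x : Fin (n H j)) (y : Fin (n H k)) : Set where
    constructor mkEdgeAt
    field
      edge   : Edge (n H)
      edge∈  : edge ∈ₗ edges H
      edge-j : edge j ≡ x
      edge-k : edge k ≡ y

    apex : Fin (n H i)
    apex = edge i
  open EdgeAt

  N⁅x⁆-nonempty : ∀ x → Nonempty (N G ⁅ x ⁆)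
  N⁅x⁆-nonempty x with PerfectMatching⇒neighbour pm-i x
  ... | y , xy∈G = y , ∈-N⁺ G xy∈G (x∈⁅x⁆ x)

  -- Kept opaque: checking the lemmas below becomes very slow if e₁₁ … e₂₂ can unfold.
  opaque
    edge-at : ∀ {x x' y} → x ∈ X → x' ∈ X → x ≢ x' → y ∈ N G X → EdgeAt x y
    edge-at {x} x∈X x'∈X x≢x' y∈NX
      with ∈-N⁻ G (minimal⇒N⊆N⁅x⁆ {G = G} minimal ∣X∣≡2 (⁅x⁆⊂p x∈X x'∈X x≢x') (N⁅x⁆-nonempty x) y∈NX)
    ... | v , vy∈G , v∈⁅x⁆ with ∈-link⁻ H i ⊤ j k vy∈G
    ... | e , e∈H , refl = mkEdgeAt e e∈H (x∈⁅y⁆⇒x≡y x v∈⁅x⁆) refl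

  e₁₁ : EdgeAt x₁ y₁
  e₁₁ = edge-at x₁∈X x₂∈X x₁≢x₂ y₁∈NX
  e₁₂ : EdgeAt x₁ y₂
  e₁₂ = edge-at x₁∈X x₂∈X x₁≢x₂ y₂∈NX
  e₂₁ : EdgeAt x₂ y₁
  e₂₁ = edge-at x₂∈X x₁∈X (≢-sym x₁≢x₂) y₁∈NX
  e₂₂ : EdgeAt x₂ y₂
  e₂₂ = edge-at x₂∈X x₁∈X (≢-sym x₁≢x₂) y₂∈NX

  apex-opposite : ∀ {y y'} → y ≢ y' → (r : EdgeAt x₁ y) (s : EdgeAt x₂ y') → apex r ≡ apex s
  apex-opposite y≢y' r s
    with intersecting (edge r) (edge s) (edge∈ r) (edge∈ s)
           (subst (_∈ X) (sym (edge-j r)) x₁∈X) (subst (_∈ X) (sym (edge-j s)) x₂∈X)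
  ... | l , er≡es with cover l
  ... | inj₁ refl        = er≡es
  ... | inj₂ (inj₁ refl) = contradiction (trans (sym (edge-j r)) (trans er≡es (edge-j s))) x₁≢x₂
  ... | inj₂ (inj₂ refl) = contradiction (trans (sym (edge-k r)) (trans er≡es (edge-k s))) y≢y'

  c₁ c₂ : Fin (n H i)
  c₁ = apex e₁₁
  c₂ = apex e₁₂

  apex₁₁ : (r : EdgeAt x₁ y₁) → apex r ≡ c₁
  apex₁₁ r = trans (apex-opposite y₁≢y₂ r e₂₂) (sym (apex-opposite y₁≢y₂ e₁₁ e₂₂))

  apex₂₂ : (r : EdgeAt x₂ y₂) → apex r ≡ c₁
  apex₂₂ r = sym (apex-opposite y₁≢y₂ e₁₁ r)

  apex₁₂ : (r : EdgeAt x₁ y₂) → apex r ≡ c₂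
  apex₁₂ r = trans (apex-opposite (≢-sym y₁≢y₂) r e₂₁) (sym (apex-opposite (≢-sym y₁≢y₂) e₁₂ e₂₁))

  apex₂₁ : (r : EdgeAt x₂ y₁) → apex r ≡ c₂
  apex₂₁ r = sym (apex-opposite (≢-sym y₁≢y₂) e₁₂ r)

  a b c x y z : Vertex (n H)
  a = j , x₁
  b = k , y₁
  c = i , c₁
  x = j , x₂
  y = k , y₂
  z = i , c₂

  FanoEdge : Edge (n H) → Set
  FanoEdge e = EdgeIs e a b c ⊎ EdgeIs e a y z ⊎ EdgeIs e x b z ⊎ EdgeIs e x y c

  cover-jki : ∀ l → l ≡ j ⊎ l ≡ k ⊎ l ≡ i
  cover-jki l with cover l
  ... | inj₁ l≡i        = inj₂ (inj₂ l≡i)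
  ... | inj₂ (inj₁ l≡j) = inj₁ l≡j
  ... | inj₂ (inj₂ l≡k) = inj₂ (inj₁ l≡k)

  fanoEdge : ∀ {e} → e ∈ₗ edges H → e j ∈ X → FanoEdge e
  fanoEdge {e} e∈H ej∈X with ∈X ej∈X | ∈NX (∈-N⁺ G (∈-link⁺ H i ⊤ j k e∈H ∈⊤) ej∈X)
  ... | inj₁ ej≡x₁ | inj₁ ek≡y₁ = inj₁ (edgeIs cover-jki ej≡x₁ ek≡y₁ (apex₁₁ (mkEdgeAt e e∈H ej≡x₁ ek≡y₁)))
  ... | inj₁ ej≡x₁ | inj₂ ek≡y₂ = inj₂ (inj₁ (edgeIs cover-jki ej≡x₁ ek≡y₂ (apex₁₂ (mkEdgeAt e e∈H ej≡x₁ ek≡y₂))))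
  ... | inj₂ ej≡x₂ | inj₁ ek≡y₁ = inj₂ (inj₂ (inj₁ (edgeIs cover-jki ej≡x₂ ek≡y₁ (apex₂₁ (mkEdgeAt e e∈H ej≡x₂ ek≡y₁)))))
  ... | inj₂ ej≡x₂ | inj₂ ek≡y₂ = inj₂ (inj₂ (inj₂ (edgeIs cover-jki ej≡x₂ ek≡y₂ (apex₂₂ (mkEdgeAt e e∈H ej≡x₂ ek≡y₂)))))

  apex-c₁⊎c₂ : ∀ {e} → FanoEdge e → e i ≡ c₁ ⊎ e i ≡ c₂
  apex-c₁⊎c₂ (inj₁ e-abc)               = inj₁ (Equivalence.from (e-abc c) (inj₂ (inj₂ refl)))
  apex-c₁⊎c₂ (inj₂ (inj₁ e-ayz))        = inj₂ (Equivalence.from (e-ayz z) (inj₂ (inj₂ refl)))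
  apex-c₁⊎c₂ (inj₂ (inj₂ (inj₁ e-xbz))) = inj₂ (Equivalence.from (e-xbz z) (inj₂ (inj₂ refl)))
  apex-c₁⊎c₂ (inj₂ (inj₂ (inj₂ e-xyc))) = inj₁ (Equivalence.from (e-xyc c) (inj₂ (inj₂ refl)))

  c₁≢c₂ : c₁ ≢ c₂
  c₁≢c₂ c₁≡c₂ = x₁≢x₂ (PerfectMatching⇒soleNeighbour-injective pm-k (sole-c₁ x₁∈X) (sole-c₁ x₂∈X))
    where
    sole-c₁ : ∀ {x} → x ∈ X → ∀ {v} → (v , x) ∈ₗ link H k ⊤ i j → v ≡ c₁
    sole-c₁ x∈X vx∈link with ∈-link⁻ H k ⊤ i j vx∈link
    ... | e , e∈H , refl = [ id , (λ ei≡c₂ → trans ei≡c₂ (sym c₁≡c₂)) ]′ (apex-c₁⊎c₂ (fanoEdge e∈H x∈X))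

  incident-truncatedMultiFano : TruncatedMultiFano (incident H j X)
  incident-truncatedMultiFano =
    a , b , c , x , y , z , distinct ,
    tabulate (uncurry′ fanoEdge ∘ ∈-incident⁻ H j X) ,
    occurs e₁₁ x₁∈X refl ,
    occurs e₁₂ x₁∈X refl ,
    occurs e₂₁ x₂∈X (apex₂₁ e₂₁) ,
    occurs e₂₂ x₂∈X (apex₂₂ e₂₂)
    where
    occurs : ∀ {x' y' c'} (r : EdgeAt x' y') → x' ∈ X → apex r ≡ c'
      → Any (λ e → EdgeIs e (j , x') (k , y') (i , c')) (incident H j X)
    occurs r x'∈X apex≡c' =
      lose (∈-incident⁺ H j X (edge∈ r) (subst (_∈ X) (sym (edge-j r)) x'∈X))
           (edgeIs cover-jki (edge-j r) (edge-k r) apex≡c')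

    distinct : Unique (a ∷ b ∷ c ∷ x ∷ y ∷ z ∷ [])
    distinct = (vertex-≢ˡ j≢k ∷ vertex-≢ˡ (≢-sym i≢j) ∷ vertex-≢ʳ x₁≢x₂ ∷ vertex-≢ˡ j≢k ∷ vertex-≢ˡ (≢-sym i≢j) ∷ [])
             ∷ (vertex-≢ˡ (≢-sym i≢k) ∷ vertex-≢ˡ (≢-sym j≢k) ∷ vertex-≢ʳ y₁≢y₂ ∷ vertex-≢ˡ (≢-sym i≢k) ∷ [])
             ∷ (vertex-≢ˡ i≢j ∷ vertex-≢ˡ i≢k ∷ vertex-≢ʳ c₁≢c₂ ∷ [])
             ∷ (vertex-≢ˡ j≢k ∷ vertex-≢ˡ (≢-sym i≢j) ∷ [])
             ∷ (vertex-≢ˡ (≢-sym i≢k) ∷ [])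
             ∷ []
             ∷ []

proposition6p1 : (H : TriGraph)
    → ((i' j' : Fin 3) → i' ≢ j' → PerfectMatching (link H i' ⊤ j' (third i' j')))
    → (i j : Fin 3) → i ≢ j
    → (X : Subset (n H j))
    → MinimalEquineighbored (link H i ⊤ j (third i j)) X
    → ∣ X ∣ ≡ 2
    → ((e f : Edge (n H)) → e ∈ₗ edges H → f ∈ₗ edges H
         → e j ∈ X → f j ∈ X → ∃[ l ] e l ≡ f l)
    → TruncatedMultiFano (incident H j X)
proposition6p1 H pm i j i≢j X minimal ∣X∣≡2 intersecting =
  IncidentToPair.incident-truncatedMultiFano H (third-distinct i≢j)
    (pm i j i≢j) pm-k minimal ∣X∣≡2 intersecting
  where
  k = third i j
  pm-k : PerfectMatching (link H k ⊤ i j)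
  pm-k = subst (PerfectMatching ∘ link H k ⊤ i) (third-third i≢j) (pm k i (Distinct₃.i≢k (third-distinct i≢j) ∘ sym))
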